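{- Let $\mathcal{S}=[0,C_1]\times\cdots\times[0,C_d]\subset\mathbb{Z}^d$ with the componentwise order, let $a$ be an ASHE with direction vector $v$ and blocking relation $\mathcal{R}$, and let $m,M\in\mathcal{S}$ with $m\le M$ and $B(m)\cup B(M)=\emptyset$. Let $[m',M']=[m,M]\boxdot a$. Then $\|M'-m'\|_1\le\|M-m\|_1$.
   Context: For $x\in\mathcal{S}$: $CR(x)=\{i: x_i+v_i\notin[0,C_i]\}$ and $B(x)=\{i:\exists j\in CR(x),\ (j,i)\in\mathcal{R}\}$. An event $a$ is an ASHE with direction vector $v\in\mathbb{Z}^d$ and blocking relation $\mathcal{R}$ (a binary relation on $\{1,\dots,d\}$) if for all $x\in\mathcal{S}$ and all $i$: $(x\cdot a)_i=x_i$ if $i\in B(x)$ and $(x\cdot a)_i=\min(\max(x_i+v_i,0),C_i)$ otherwise. $[m,M]=\{x\in\mathcal{S}: m\le x\le M\}$, and $[m,M]\boxdot a=[\inf_{x\in[m,M]}x\cdot a,\ \sup_{x\in[m,M]}x\cdot a]$ (componentwise inf/sup). $\|y\|_1=\sum_i|y_i|$. -}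

module Defs where

open import Data.Nat using (ℕ; zero; suc)
import Data.Nat as ℕ
open import Data.Integer using (ℤ; +_; _+_; _-_; _≤_; _<_; _⊓_; _⊔_; ∣_∣)
open import Data.Fin using (Fin; zero; suc)
open import Data.Product using (_×_; Σ; ∃; ∃-syntax)
open import Data.Sum using (_⊎_)
open import Relation.Nullary using (¬_)
open import Relation.Binary.PropositionalEquality using (_≡_)

Vecℤ : ℕ → Set
Vecℤ d = Fin d → ℤ

_≤ᵥ_ : ∀ {d} → Vecℤ d → Vecℤ d → Set
x ≤ᵥ y = ∀ i → x i ≤ y i

InS : ∀ {d} → (Fin d → ℕ) → Vecℤ d → Set
InS C x = ∀ i → (+ 0 ≤ x i) × (x i ≤ + C i)

InBox : ∀ {d} → (Fin d → ℕ) → Vecℤ d → Vecℤ d → Vecℤ d → Set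
InBox C m M x = InS C x × (m ≤ᵥ x) × (x ≤ᵥ M)

CR : ∀ {d} → (Fin d → ℕ) → Vecℤ d → Vecℤ d → Fin d → Set
CR C v x i = (x i + v i < + 0) ⊎ (+ C i < x i + v i)

B : ∀ {d} → (Fin d → ℕ) → Vecℤ d → (Fin d → Fin d → Set) → Vecℤ d → Fin d → Set
B C v R x i = ∃[ j ] (CR C v x j × R j i)

clamp : ℤ → ℕ → ℤ
clamp t c = (t ⊔ + 0) ⊓ + c

-- The event a (a map on states; only its values on S matter) is an ASHE
-- with direction vector v and blocking relation R.
IsASHE : ∀ {d} → (Fin d → ℕ) → Vecℤ d → (Fin d → Fin d → Set)
       → (Vecℤ d → Vecℤ d) → Set
IsASHE C v R a = ∀ x → InS C x → ∀ i →
  (B C v R x i → a x i ≡ x i) × (¬ B C v R x i → a x i ≡ clamp (x i + v i) (C i))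

IsInfImage : ∀ {d} → (Fin d → ℕ) → (Vecℤ d → Vecℤ d) → Vecℤ d → Vecℤ d → Vecℤ d → Set
IsInfImage C a m M m' = ∀ i →
  (∀ x → InBox C m M x → m' i ≤ a x i) ×
  (∀ (l : ℤ) → (∀ x → InBox C m M x → l ≤ a x i) → l ≤ m' i)

IsSupImage : ∀ {d} → (Fin d → ℕ) → (Vecℤ d → Vecℤ d) → Vecℤ d → Vecℤ d → Vecℤ d → Set
IsSupImage C a m M M' = ∀ i →
  (∀ x → InBox C m M x → a x i ≤ M' i) ×
  (∀ (u : ℤ) → (∀ x → InBox C m M x → a x i ≤ u) → M' i ≤ u)

sumFin : ∀ {d} → (Fin d → ℕ) → ℕ
sumFin {zero} f = 0
sumFin {suc d} f = f zero ℕ.+ sumFin (λ i → f (suc i))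

norm1 : ∀ {d} → Vecℤ d → ℕ
norm1 y = sumFin (λ i → ∣ y i ∣)

_-ᵥ_ : ∀ {d} → Vecℤ d → Vecℤ d → Vecℤ d
(x -ᵥ y) i = x i - y i

module Submission where

-- Away from blocking, an ASHE acts on each coordinate
-- by the scalar map  f_i = step v_i C_i,  f_i(t) = clamp (t + v_i) C_i = min(max(t + v_i, 0), C_i),
-- a composite of a translation, a maximum and a minimum with constants.
-- Each of these is monotone and does not expand the distance between two
-- points, hence so is f_i.
--   * Since B(m) and B(M) are empty and critical coordinates of a point
--     between m and M are critical for m or for M, no point of [m,M] is
--     blocked: the event acts on the whole box by the maps f_i.
--   * By monotonicity, f_i(m_i) ≤ m'_i ≤ M'_i ≤ f_i(M_i); by
--     non-expansiveness, M'_i - m'_i ≤ f_i(M_i) - f_i(m_i) ≤ M_i - m_i.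
--   * Summing these coordinatewise bounds gives the ℓ¹ estimate.

open import Defs
open import Data.Nat using (ℕ; _≤_)
open import Data.Fin using (Fin)
open import Data.Integer using (ℤ)
open import Relation.Nullary using (¬_)

import Data.Nat as ℕ
import Data.Nat.Properties as ℕ
open import Data.Fin using (zero; suc)
import Data.Integer as ℤ
open import Data.Integer using (+_; _+_; _-_; -_; _⊔_; _⊓_; ∣_∣; 0ℤ)
import Data.Integer.Properties as ℤ
open import Data.Integer.Solver using (module +-*-Solver)
open import Data.Product using (_,_; proj₁; proj₂)
open import Data.Sum using (_⊎_; inj₁; inj₂)
open import Relation.Binary.Definitions using (Monotonic₁)
open import Relation.Binary.PropositionalEquality using (_≡_; refl; sym; cong; subst)
open +-*-Solver using (solve; _:+_; _:-_; _:=_)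

sumFin-mono : ∀ {d} (f g : Fin d → ℕ) → (∀ i → f i ≤ g i) → sumFin f ≤ sumFin g
sumFin-mono {ℕ.zero}  f g f≤g = ℕ.z≤n
sumFin-mono {ℕ.suc d} f g f≤g =
  ℕ.+-mono-≤ (f≤g zero) (sumFin-mono (λ i → f (suc i)) (λ i → g (suc i)) (λ i → f≤g (suc i)))

NonExpansive : (ℤ → ℤ) → Set
NonExpansive f = ∀ {x y} → x ℤ.≤ y → f y - f x ℤ.≤ y - x

Monotone : (ℤ → ℤ) → Set
Monotone = Monotonic₁ ℤ._≤_ ℤ._≤_

≤+⇒-≤ : ∀ {a b k} → a ℤ.≤ b + k → a - b ℤ.≤ k
≤+⇒-≤ {a} {b} {k} a≤b+k = subst (a - b ℤ.≤_) (solve 2 (λ b k → (b :+ k) :- b := k) refl b k)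
                                  (ℤ.+-monoˡ-≤ (- b) a≤b+k)

≤+nonneg : ∀ i {k} → 0ℤ ℤ.≤ k → i ℤ.≤ i + k
≤+nonneg i {k} 0≤k = subst (ℤ._≤ i + k) (ℤ.+-identityʳ i) (ℤ.+-monoʳ-≤ i 0≤k)

+-minus-cancel : ∀ x y → x + (y - x) ≡ y
+-minus-cancel = solve 2 (λ x y → x :+ (y :- x) := y) refl

translate-nonExpansive : ∀ v → NonExpansive (_+ v)
translate-nonExpansive v {x} {y} _ =
  ℤ.≤-reflexive (solve 3 (λ x y v → (y :+ v) :- (x :+ v) := y :- x) refl x y v)

-- For ∙ ∈ {⊔, ⊓}: translating x ∙ c by k = y - x ≥ 0 gives y ∙ (c + k),
-- which dominates y ∙ c; this is the non-expansiveness of (_∙ c).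
⊔-nonExpansive : ∀ c → NonExpansive (_⊔ c)
⊔-nonExpansive c {x} {y} x≤y = ≤+⇒-≤ (begin
  y ⊔ c                 ≤⟨ ℤ.⊔-monoʳ-≤ y (≤+nonneg c (ℤ.i≤j⇒0≤j-i x≤y)) ⟩
  y ⊔ (c + (y - x))     ≡⟨ cong (_⊔ (c + (y - x))) (sym (+-minus-cancel x y)) ⟩
  (x + (y - x)) ⊔ (c + (y - x)) ≡⟨ sym (ℤ.mono-≤-distrib-⊔ (ℤ.+-monoˡ-≤ (y - x)) x c) ⟩
  (x ⊔ c) + (y - x)     ∎)
  where open ℤ.≤-Reasoning

⊓-nonExpansive : ∀ c → NonExpansive (_⊓ c)
⊓-nonExpansive c {x} {y} x≤y = ≤+⇒-≤ (begin
  y ⊓ c                 ≤⟨ ℤ.⊓-monoʳ-≤ y (≤+nonneg c (ℤ.i≤j⇒0≤j-i x≤y)) ⟩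
  y ⊓ (c + (y - x))     ≡⟨ cong (_⊓ (c + (y - x))) (sym (+-minus-cancel x y)) ⟩
  (x + (y - x)) ⊓ (c + (y - x)) ≡⟨ sym (ℤ.mono-≤-distrib-⊓ (ℤ.+-monoˡ-≤ (y - x)) x c) ⟩
  (x ⊓ c) + (y - x)     ∎)
  where open ℤ.≤-Reasoning

∘-nonExpansive : ∀ f g → NonExpansive f → Monotone g → NonExpansive g →
                 NonExpansive (λ t → f (g t))
∘-nonExpansive f g f-ne g-mono g-ne x≤y = ℤ.≤-trans (f-ne (g-mono x≤y)) (g-ne x≤y)

step : ℤ → ℕ → ℤ → ℤ
step v c t = clamp (t + v) c

step-mono : ∀ v c → Monotone (step v c)
step-mono v c x≤y = ℤ.⊓-monoˡ-≤ (+ c) (ℤ.⊔-monoˡ-≤ (+ 0) (ℤ.+-monoˡ-≤ v x≤y))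

step-nonExpansive : ∀ v c → NonExpansive (step v c)
step-nonExpansive v c =
  ∘-nonExpansive (_⊓ + c) (λ t → (t + v) ⊔ + 0) (⊓-nonExpansive (+ c))
    (λ x≤y → ℤ.⊔-monoˡ-≤ (+ 0) (ℤ.+-monoˡ-≤ v x≤y))
    (∘-nonExpansive (_⊔ + 0) (_+ v) (⊔-nonExpansive (+ 0)) (ℤ.+-monoˡ-≤ v) (translate-nonExpansive v))

∣∣-mono-nonneg : ∀ {a b} → 0ℤ ℤ.≤ a → a ℤ.≤ b → ∣ a ∣ ≤ ∣ b ∣
∣∣-mono-nonneg {a} {b} 0≤a a≤b = ℤ.drop‿+≤+ (begin
  + ∣ a ∣  ≡⟨ ℤ.0≤i⇒+∣i∣≡i 0≤a ⟩
  a        ≤⟨ a≤b ⟩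
  b        ≡⟨ sym (ℤ.0≤i⇒+∣i∣≡i (ℤ.≤-trans 0≤a a≤b)) ⟩
  + ∣ b ∣  ∎)
  where open ℤ.≤-Reasoning

module _ {d} (C : Fin d → ℕ) (v : Vecℤ d) (R : Fin d → Fin d → Set) {m M : Vecℤ d} where

  -- A coordinate critical for a point of [m,M] is critical for m or for M:
  -- leaving [0,C_j] downwards at x_j happens also at m_j ≤ x_j, and
  -- upwards also at M_j ≥ x_j.
  CR-box : ∀ {x} → InBox C m M x → ∀ {j} → CR C v x j → CR C v m j ⊎ CR C v M j
  CR-box (_ , m≤x , _) {j} (inj₁ under) = inj₁ (inj₁ (ℤ.≤-<-trans (ℤ.+-monoˡ-≤ (v j) (m≤x j)) under))
  CR-box (_ , _ , x≤M) {j} (inj₂ over)  = inj₂ (inj₂ (ℤ.<-≤-trans over (ℤ.+-monoˡ-≤ (v j) (x≤M j))))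

  unblocked-box : (∀ i → ¬ B C v R m i) → (∀ i → ¬ B C v R M i) →
                  ∀ {x} → InBox C m M x → ∀ i → ¬ B C v R x i
  unblocked-box m-free M-free x∈box i (j , j-crit , jRi) with CR-box x∈box j-crit
  ... | inj₁ m-crit = m-free i (j , m-crit , jRi)
  ... | inj₂ M-crit = M-free i (j , M-crit , jRi)

  module _ {a : Vecℤ d → Vecℤ d} (ashe : IsASHE C v R a)
           (m-free : ∀ i → ¬ B C v R m i) (M-free : ∀ i → ¬ B C v R M i) where

    ashe-on-box : ∀ {x} → InBox C m M x → ∀ i → a x i ≡ step (v i) (C i) (x i)
    ashe-on-box {x} x∈box i = proj₂ (ashe x (proj₁ x∈box) i) (unblocked-box m-free M-free x∈box i)

    step-m≤inf : ∀ {m'} → IsInfImage C a m M m' → ∀ i → step (v i) (C i) (m i) ℤ.≤ m' i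
    step-m≤inf inf i = proj₂ (inf i) _ λ x x∈box →
      subst (step (v i) (C i) (m i) ℤ.≤_) (sym (ashe-on-box x∈box i))
            (step-mono (v i) (C i) (proj₁ (proj₂ x∈box) i))

    sup≤step-M : ∀ {M'} → IsSupImage C a m M M' → ∀ i → M' i ℤ.≤ step (v i) (C i) (M i)
    sup≤step-M sup i = proj₂ (sup i) _ λ x x∈box →
      subst (ℤ._≤ step (v i) (C i) (M i)) (sym (ashe-on-box x∈box i))
            (step-mono (v i) (C i) (proj₂ (proj₂ x∈box) i))

proposition1 : (d : ℕ) (C : Fin d → ℕ) (v : Fin d → ℤ) (R : Fin d → Fin d → Set)
    (a : Vecℤ d → Vecℤ d) → IsASHE C v R a →
    (m M : Vecℤ d) → InS C m → InS C M → m ≤ᵥ M →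
    (∀ i → ¬ B C v R m i) → (∀ i → ¬ B C v R M i) →
    (m' M' : Vecℤ d) → IsInfImage C a m M m' → IsSupImage C a m M M' →
    norm1 (M' -ᵥ m') ≤ norm1 (M -ᵥ m)
proposition1 d C v R a ashe m M m∈S M∈S m≤M m-free M-free m' M' inf sup =
  sumFin-mono _ _ λ i → ∣∣-mono-nonneg (ℤ.i≤j⇒0≤j-i (inf≤sup i)) (shrink i)
  where
  m∈box : InBox C m M m
  m∈box = m∈S , (λ i → ℤ.≤-refl) , m≤M

  -- m'_i ≤ (m·a)_i ≤ M'_i.
  inf≤sup : ∀ i → m' i ℤ.≤ M' i
  inf≤sup i = ℤ.≤-trans (proj₁ (inf i) m m∈box) (proj₁ (sup i) m m∈box)

  -- M'_i - m'_i ≤ f_i(M_i) - f_i(m_i) ≤ M_i - m_i.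
  shrink : ∀ i → M' i - m' i ℤ.≤ M i - m i
  shrink i = ℤ.≤-trans
    (ℤ.+-mono-≤ (sup≤step-M C v R ashe m-free M-free sup i)
                (ℤ.neg-mono-≤ (step-m≤inf C v R ashe m-free M-free inf i)))
    (step-nonExpansive (v i) (C i) (m≤M i))
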